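{- Let $G=(V,E)$ be an acyclic transitive directed graph and let $H$ be an orientation of the complement $\overline{G}$ of $G$. Then the graph $G\setminus\mathcal{U}(H^*)$, i.e. the graph on $V$ with edge set $E\setminus\big(E_H^*\cup (E_H^*)^{ -1}\big)$ where $H^*=(V,E_H^*)$ is the transitive closure of $H$, is 2-dimensional.
   Context: All graphs are simple and directed; an undirected edge is represented as a pair of opposite directed edges. For $G=(V,E)$, $E^{ -1}=\{(b,a)\mid (a,b)\in E\}$, $\mathcal{U}(G)=(V,E\cup E^{ -1})$ is the undirected closure, and the complement of $G$ is the graph $(V,\{(a,b)\mid a,b\in V,\ a\neq b\}\setminus (E\cup E^{ -1}))$. A graph is transitive if $(a,b),(b,c)\in E$ with $a\neq c$ implies $(a,c)\in E$; the transitive closure $H^*$ of $H$ has as edge set the minimal transitive superset of the edges of $H$. A graph $(V,E)$ is oriented if $E\cap E^{ -1}=\emptyset$; $(V,E')$ is an orientation of $(V,E)$ if $E'$ is a maximal oriented subset of $E$. An acyclic transitive graph is viewed as a strict partial order on $V$; it is 2-dimensional if its order dimension is at most 2, i.e. its edge relation is the intersection of (at most) two linear orders on $V$. -}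

module Defs where

open import Data.Nat using (ℕ)
open import Data.Fin using (Fin)
open import Data.Bool using (Bool; true; false)
open import Data.Product using (_×_; Σ-syntax)
open import Data.Sum using (_⊎_)
open import Relation.Binary.PropositionalEquality using (_≡_; _≢_)
open import Relation.Nullary using (¬_)
open import Relation.Binary.Core using (Rel)
open import Relation.Binary.Construct.Closure.Transitive using (TransClosure)
open import Level using (0ℓ)

Adj : ℕ → Set
Adj n = Fin n → Fin n → Bool

Edge : ∀ {n} → Adj n → Rel (Fin n) 0ℓ
Edge E a b = E a b ≡ true

Simple : ∀ {n} → Adj n → Set
Simple E = ∀ a → E a a ≡ false

-- transitivity as in the paper: (a,b),(b,c) ∈ E, a ≠ c ⇒ (a,c) ∈ E
Transitive : ∀ {n} → Rel (Fin n) 0ℓ → Set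
Transitive R = ∀ a b c → R a b → R b c → a ≢ c → R a c

Acyclic : ∀ {n} → Adj n → Set
Acyclic E = ∀ a → ¬ TransClosure (Edge E) a a

ComplEdge : ∀ {n} → Adj n → Rel (Fin n) 0ℓ
ComplEdge E a b = a ≢ b × ¬ Edge E a b × ¬ Edge E b a

-- H is an orientation of the graph with edge relation R:
-- H ⊆ R, H is oriented, and H is maximal among oriented subsets of R
-- (adding any edge of R not in H destroys orientedness).
IsOrientationOf : ∀ {n} → Adj n → Rel (Fin n) 0ℓ → Set
IsOrientationOf H R =
  (∀ a b → Edge H a b → R a b) ×
  (∀ a b → Edge H a b → ¬ Edge H b a) ×
  (∀ a b → R a b → ¬ Edge H a b → Edge H b a)

-- edge relation of the transitive closure H* of a simple graph H
-- (minimal transitive superset, transitivity in the loop-free sense above)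
TCEdge : ∀ {n} → Adj n → Rel (Fin n) 0ℓ
TCEdge H a b = TransClosure (Edge H) a b × a ≢ b

MinusUTC : ∀ {n} → Adj n → Adj n → Rel (Fin n) 0ℓ
MinusUTC G H a b = Edge G a b × ¬ TCEdge H a b × ¬ TCEdge H b a

IsLinearOrder : ∀ {n} → Rel (Fin n) 0ℓ → Set
IsLinearOrder L =
  (∀ a → ¬ L a a) ×
  (∀ a b c → L a b → L b c → L a c) ×
  (∀ a b → a ≢ b → L a b ⊎ L b a)

-- 2-dimensional: the edge relation is the intersection of two linear orders
-- (at most two: a single linear order L is L ∩ L)
TwoDimensional : ∀ {n} → Rel (Fin n) 0ℓ → Set₁
TwoDimensional {n} R =
  Σ[ L₁ ∈ Rel (Fin n) 0ℓ ] Σ[ L₂ ∈ Rel (Fin n) 0ℓ ]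
    IsLinearOrder L₁ × IsLinearOrder L₂ ×
    (∀ a b → (R a b → L₁ a b × L₂ a b) × (L₁ a b × L₂ a b → R a b))

-- Write T for the edge relation of H* and put, for a strict order G,
--   P a b = G a b, with a and b not joined by T in either direction,
--   F a b = T a b, where a pair joined both ways is broken by vertex index,
--   L_G   = P ∪ F.
-- The heart of the proof is a crossing lemma: an H-path from x to y cannot
-- jump over a vertex m with x <_G m <_G y without passing through m, since
-- every vertex of the path is G-comparable to m or H-adjacent to it.
-- From it, L_G is a strict linear order.  The construction only needs that
-- H lies in, and covers, the incomparability graph of G, a hypothesis that
-- is invariant under reversing G, so L_{G⁻¹} is a linear order as well.
-- The intersection of L_G with the reverse of L_{G⁻¹} is exactly P, which is
-- G ∖ U(H*).
module Submission where

open import Defs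
open import Data.Nat using (ℕ)
open import Data.Fin using (Fin; _≟_; _<_)
open import Data.Fin.Properties using (<-asym; <-cmp; <-trans)
open import Data.Bool using (true)
import Data.Bool as Bool
open import Data.List using (List; []; _∷_; allFin)
open import Data.List.Membership.Propositional using (_∈_)
open import Data.List.Membership.Propositional.Properties using (∈-allFin)
open import Data.List.Relation.Unary.Any using (here; there)
open import Data.Product using (_×_; _,_; proj₁; proj₂)
open import Data.Sum using (_⊎_; inj₁; inj₂; map₁) renaming (map to ⊎-map)
open import Data.Empty using (⊥-elim)
open import Function using (flip; _∘_)
open import Relation.Nullary using (¬_; yes; no)
open import Relation.Nullary.Decidable using (_⊎-dec_; _×-dec_; ¬?; map′)
open import Relation.Binary.Core using (Rel)
open import Relation.Binary.Definitions using (Decidable; tri<; tri≈; tri>)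
open import Relation.Binary.PropositionalEquality using (_≢_; refl; sym)
open import Relation.Binary.Construct.Closure.Transitive using (TransClosure; [_]; _∷_; _++_)
open import Level using (0ℓ)

module Warshall {A : Set} (R : Rel A 0ℓ) (R? : Decidable R) where

  -- Via cs a b: an R-path from a to b all of whose interior vertices lie in
  -- cs, organised by the first pivot of cs it passes through.
  Via : List A → Rel A 0ℓ
  Via []       a b = R a b
  Via (c ∷ cs) a b = Via cs a b ⊎ (Via cs a c × Via cs c b)

  via? : ∀ cs → Decidable (Via cs)
  via? []       a b = R? a b
  via? (c ∷ cs) a b = via? cs a b ⊎-dec (via? cs a c ×-dec via? cs c b)

  via⇒closure : ∀ cs {a b} → Via cs a b → TransClosure R a b
  via⇒closure []       r                = [ r ]
  via⇒closure (c ∷ cs) (inj₁ p)         = via⇒closure cs p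
  via⇒closure (c ∷ cs) (inj₂ (p , q))   = via⇒closure cs p ++ via⇒closure cs q

  edge⇒via : ∀ cs {a b} → R a b → Via cs a b
  edge⇒via []       r = r
  edge⇒via (c ∷ cs) r = inj₁ (edge⇒via cs r)

  into-pivot : ∀ c cs {a} → Via (c ∷ cs) a c → Via cs a c
  into-pivot _ _ (inj₁ p)       = p
  into-pivot _ _ (inj₂ (p , _)) = p

  out-of-pivot : ∀ c cs {b} → Via (c ∷ cs) c b → Via cs c b
  out-of-pivot _ _ (inj₁ q)       = q
  out-of-pivot _ _ (inj₂ (_ , q)) = q

  glue : ∀ {cs a b c} → c ∈ cs → Via cs a c → Via cs c b → Via cs a b
  glue {c ∷ cs} (here refl) p q = inj₂ (into-pivot c cs p , out-of-pivot c cs q)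
  glue (there c∈) (inj₁ p)        (inj₁ q)        = inj₁ (glue c∈ p q)
  glue (there c∈) (inj₁ p)        (inj₂ (q , q′)) = inj₂ (glue c∈ p q , q′)
  glue (there c∈) (inj₂ (p , p′)) (inj₁ q)        = inj₂ (p , glue c∈ p′ q)
  glue (there c∈) (inj₂ (p , _))  (inj₂ (_ , q′)) = inj₂ (p , q′)

  closure⇒via : ∀ {cs} → (∀ x → x ∈ cs) → ∀ {a b} → TransClosure R a b → Via cs a b
  closure⇒via {cs} all [ r ] = edge⇒via cs r
  closure⇒via {cs} all (_∷_ {y = c} r p) = glue (all c) (edge⇒via cs r) (closure⇒via all p)

  closure? : ∀ cs → (∀ x → x ∈ cs) → Decidable (TransClosure R)
  closure? cs all a b = map′ (via⇒closure cs) (closure⇒via all) (via? cs a b)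

Reach : ∀ {n} → Rel (Fin n) 0ℓ → Rel (Fin n) 0ℓ
Reach H a b = TransClosure H a b × a ≢ b

reach? : ∀ {n} {H : Rel (Fin n) 0ℓ} → Decidable H → Decidable (Reach H)
reach? {n} H? a b = closure? (allFin n) ∈-allFin a b ×-dec ¬? (a ≟ b)
  where open Warshall _ H?

reach-trans : ∀ {n} {H : Rel (Fin n) 0ℓ} {a b c} →
              Reach H a b → Reach H b c → a ≢ c → Reach H a c
reach-trans (p , _) (q , _) a≢c = p ++ q , a≢c

record Directs {n} (G H : Rel (Fin n) 0ℓ) : Set where
  field
    G?           : Decidable G
    irrefl       : ∀ a → ¬ G a a
    trans        : ∀ {a b c} → G a b → G b c → G a c
    incomparable : ∀ {a b} → H a b → ¬ G a b × ¬ G b a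
    covers       : ∀ {a b} → a ≢ b → ¬ G a b → ¬ G b a → H a b ⊎ H b a

  distinct : ∀ {a b} → G a b → a ≢ b
  distinct {a} g refl = irrefl a g

reverse : ∀ {n} {G H : Rel (Fin n) 0ℓ} → Directs G H → Directs (flip G) H
reverse S = record
  { G?           = flip G?
  ; irrefl       = irrefl
  ; trans        = flip trans
  ; incomparable = λ h → proj₂ (incomparable h) , proj₁ (incomparable h)
  ; covers       = λ a≢b ¬g ¬g′ → covers a≢b ¬g′ ¬g
  }
  where open Directs S

-- Walk along the path: a vertex above m is impossible
-- (its first edge would join G-comparable vertices), a vertex below m lets us
-- continue, and a vertex incomparable to m is H-joined to it.
module Crossing {n} {G H : Rel (Fin n) 0ℓ} (S : Directs G H) where
  open Directs S

  crossing : ∀ {x m y} → TransClosure H x y → G x m → G m y →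
             TransClosure H x m ⊎ TransClosure H m y
  crossing [ h ] g₁ g₂ = ⊥-elim (proj₁ (incomparable h) (trans g₁ g₂))
  crossing {m = m} (_∷_ {y = x₁} h p) g₁ g₂ with G? x₁ m
  ... | yes g = map₁ (h ∷_) (crossing p g g₂)
  ... | no ¬g with G? m x₁
  ...   | yes g = ⊥-elim (proj₁ (incomparable h) (trans g₁ g))
  ...   | no ¬g′ with x₁ ≟ m
  ...     | yes refl = inj₁ [ h ]
  ...     | no x₁≢m with covers x₁≢m ¬g ¬g′
  ...       | inj₁ h′ = inj₁ (h ∷ [ h′ ])
  ...       | inj₂ h′ = inj₂ (h′ ∷ p)

  no-crossing : ∀ {x m y} → G x m → G m y →
                ¬ Reach H x m → ¬ Reach H m y → ¬ Reach H x y
  no-crossing g₁ g₂ ¬xm ¬my (p , _) with crossing p g₁ g₂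
  ... | inj₁ q = ¬xm (q , distinct g₁)
  ... | inj₂ q = ¬my (q , distinct g₂)

module LinearExtension {n} {G H : Rel (Fin n) 0ℓ} (S : Directs G H) (H? : Decidable H) where
  open Directs S

  T : Rel (Fin n) 0ℓ
  T = Reach H

  P : Rel (Fin n) 0ℓ
  P a b = G a b × ¬ T a b × ¬ T b a

  F : Rel (Fin n) 0ℓ
  F a b = T a b × (T b a → a < b)

  L : Rel (Fin n) 0ℓ
  L a b = P a b ⊎ F a b

  F-asym : ∀ {a b} → F a b → ¬ F b a
  F-asym (t , tie) (t′ , tie′) = <-asym (tie t′) (tie′ t)

  F-trans : ∀ {a b c} → F a b → F b c → F a c
  F-trans {a} {b} {c} f₁@(tab , tie₁) f₂@(tbc , tie₂) = reach-trans tab tbc a≢c , tie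
    where
      a≢c : a ≢ c
      a≢c refl = F-asym f₁ f₂
      tie : T c a → a < c
      tie tca = <-trans (tie₁ (reach-trans tbc tca (proj₂ tab ∘ sym)))
                                 (tie₂ (reach-trans tca tab (proj₂ tbc ∘ sym)))

  separate : ∀ {a b} → a ≢ b → ¬ T a b → ¬ T b a → P a b ⊎ P b a
  separate {a} {b} a≢b ¬tab ¬tba with G? a b | G? b a
  ... | yes g | _     = inj₁ (g , ¬tab , ¬tba)
  ... | no _  | yes g = inj₂ (g , ¬tba , ¬tab)
  ... | no ¬g | no ¬g′ with covers a≢b ¬g ¬g′
  ...   | inj₁ h = ⊥-elim (¬tab ([ h ] , a≢b))
  ...   | inj₂ h = ⊥-elim (¬tba ([ h ] , a≢b ∘ sym))

  L-total : ∀ a b → a ≢ b → L a b ⊎ L b a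
  L-total a b a≢b with reach? H? a b | reach? H? b a
  ... | yes tab | no ¬tba = inj₁ (inj₂ (tab , ⊥-elim ∘ ¬tba))
  ... | no ¬tab | yes tba = inj₂ (inj₂ (tba , ⊥-elim ∘ ¬tab))
  ... | no ¬tab | no ¬tba = ⊎-map inj₁ inj₁ (separate a≢b ¬tab ¬tba)
  ... | yes tab | yes tba with <-cmp a b
  ...   | tri< a<b _ _ = inj₁ (inj₂ (tab , λ _ → a<b))
  ...   | tri≈ _ a≡b _ = ⊥-elim (a≢b a≡b)
  ...   | tri> _ _ b<a = inj₂ (inj₂ (tba , λ _ → b<a))

  P-trans : ∀ {a b c} → P a b → P b c → P a c
  P-trans (gab , ¬tab , ¬tba) (gbc , ¬tbc , ¬tcb) =
    trans gab gbc ,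
    Crossing.no-crossing S gab gbc ¬tab ¬tbc ,
    Crossing.no-crossing (reverse S) gbc gab ¬tcb ¬tba

  L-intro : ∀ {a c} → a ≢ c → ¬ T c a → (¬ T a c → ¬ G c a) → L a c
  L-intro {a} {c} a≢c ¬tca ¬below with reach? H? a c
  ... | yes tac = inj₂ (tac , ⊥-elim ∘ ¬tca)
  ... | no ¬tac with separate a≢c ¬tac ¬tca
  ...   | inj₁ p         = inj₁ p
  ...   | inj₂ (gca , _) = ⊥-elim (¬below ¬tac gca)

  PF-trans : ∀ {a b c} → P a b → F b c → L a c
  PF-trans {a} {b} {c} (gab , _ , ¬tba) (tbc , _) = L-intro a≢c ¬tca ¬below
    where
      a≢c : a ≢ c
      a≢c refl = ¬tba tbc
      ¬tca : ¬ T c a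
      ¬tca tca = ¬tba (reach-trans tbc tca (distinct gab ∘ sym))
      ¬below : ¬ T a c → ¬ G c a
      ¬below ¬tac gca = Crossing.no-crossing (reverse S) gab gca ¬tba ¬tac tbc

  FP-trans : ∀ {a b c} → F a b → P b c → L a c
  FP-trans {a} {b} {c} (tab , _) (gbc , _ , ¬tcb) = L-intro a≢c ¬tca ¬below
    where
      a≢c : a ≢ c
      a≢c refl = ¬tcb tab
      ¬tca : ¬ T c a
      ¬tca tca = ¬tcb (reach-trans tca tab (distinct gbc ∘ sym))
      ¬below : ¬ T a c → ¬ G c a
      ¬below ¬tac gca = Crossing.no-crossing (reverse S) gca gbc ¬tac ¬tcb tab

  L-trans : ∀ a b c → L a b → L b c → L a c
  L-trans _ _ _ (inj₁ p) (inj₁ q) = inj₁ (P-trans p q)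
  L-trans _ _ _ (inj₁ p) (inj₂ f) = PF-trans p f
  L-trans _ _ _ (inj₂ f) (inj₁ p) = FP-trans f p
  L-trans _ _ _ (inj₂ f) (inj₂ g) = inj₂ (F-trans f g)

  L-irrefl : ∀ a → ¬ L a a
  L-irrefl a (inj₁ (g , _))         = irrefl a g
  L-irrefl a (inj₂ ((_ , a≢a) , _)) = a≢a refl

  linear : IsLinearOrder L
  linear = L-irrefl , L-trans , L-total

reverse-linear : ∀ {n} {L : Rel (Fin n) 0ℓ} → IsLinearOrder L → IsLinearOrder (flip L)
reverse-linear (irr , tr , tot) =
  irr , (λ a b c p q → tr c b a q p) , (λ a b a≢b → tot b a (a≢b ∘ sym))

-- The general form of the corollary: G ∖ U(H*) = L_G ∩ L_{G⁻¹}⁻¹.  The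
-- only pairs in both orders outside P would be F-edges in both directions.
two-dimensional : ∀ {n} {G H : Rel (Fin n) 0ℓ} → Directs G H → Decidable H →
                  TwoDimensional (λ a b → G a b × ¬ Reach H a b × ¬ Reach H b a)
two-dimensional S H? =
  L₁.L , flip L₂.L , L₁.linear , reverse-linear L₂.linear ,
  λ a b → (λ p → inj₁ p , inj₁ (swap p)) , meet
  where
    module L₁ = LinearExtension S H?
    module L₂ = LinearExtension (reverse S) H?
    swap : ∀ {a b} → L₁.P a b → L₂.P b a
    swap (g , ¬tab , ¬tba) = g , ¬tba , ¬tab
    meet : ∀ {a b} → L₁.L a b × L₂.L b a → L₁.P a b
    meet (inj₁ p , _)                      = p
    meet (inj₂ _ , inj₁ (g , ¬tba , ¬tab)) = g , ¬tab , ¬tba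
    meet (inj₂ f , inj₂ f′)                = ⊥-elim (L₁.F-asym f f′)

edge? : ∀ {n} (E : Adj n) → Decidable (Edge E)
edge? E a b = E a b Bool.≟ true

directs : ∀ {n} (G H : Adj n) → Acyclic G → Transitive (Edge G) →
          IsOrientationOf H (ComplEdge G) → Directs (Edge G) (Edge H)
directs G H acyclic transitive (inside , _ , maximal) = record
  { G?           = edge? G
  ; irrefl       = λ a g → acyclic a [ g ]
  ; trans        = trans
  ; incomparable = λ {a} {b} h → proj₂ (inside a b h)
  ; covers       = covers
  }
  where
    trans : ∀ {a b c} → Edge G a b → Edge G b c → Edge G a c
    trans {a} {b} {c} g₁ g₂ = transitive a b c g₁ g₂ λ { refl → acyclic a (g₁ ∷ [ g₂ ]) }
    covers : ∀ {a b} → a ≢ b → ¬ Edge G a b → ¬ Edge G b a → Edge H a b ⊎ Edge H b a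
    covers {a} {b} a≢b ¬g ¬g′ with edge? H a b
    ... | yes h = inj₁ h
    ... | no ¬h = inj₂ (maximal a b (a≢b , ¬g , ¬g′) ¬h)

corollary9 : (n : ℕ) (G H : Adj n) →
    Simple G → Simple H →
    Acyclic G → Transitive (Edge G) →
    IsOrientationOf H (ComplEdge G) →
    TwoDimensional (MinusUTC G H)
corollary9 n G H _ _ acyclic transitive orientation =
  two-dimensional (directs G H acyclic transitive orientation) (edge? H)
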